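{- Let $n\ge 1$ and let ${\cal OCT}_n$ be the set of order-preserving full contractions of $X_n=\{1,\dots,n\}$. For integers $1\le m\le k\le n$, the number of $\alpha\in{\cal OCT}_n$ with $f(\alpha)=m$ and $w^+(\alpha)=k$ is $\sum_{p=m}^{k}\binom{n-m-1}{n-p-1}$.
   Context: Full transformations are maps $\alpha:X_n\to X_n$, written $x\mapsto x\alpha$. Order-preserving: $x\le y\Rightarrow x\alpha\le y\alpha$. Contraction: $|x\alpha-y\alpha|\le|x-y|$ for all $x,y$. $f(\alpha)=|\{x:x\alpha=x\}|$, $w^+(\alpha)=\max(\mathrm{Im}\,\alpha)$. Binomial coefficients $\binom{a}{b}$ with $a\ge -1$ are $0$ if $b<0$ or $b>a$, except $\binom{ -1}{ -1}=1$. -}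

module Defs where

open import Data.Nat using (ℕ; zero; suc; _≤_; _⊔_; _∸_; _+_; ∣_-_∣)
open import Data.Nat.Combinatorics using (_C_)
open import Data.Integer using (ℤ; +_; -[1+_])
open import Data.Fin using (Fin; toℕ; _≟_)
open import Data.Vec using (Vec; lookup; foldr′)
open import Data.List using (List; length; filter; allFin; applyUpTo)
open import Data.Nat.ListAction using (sum)
open import Data.Product using (_×_)

-- X_n = {1,…,n} is modelled by Fin n, where i : Fin n stands for toℕ i + 1.
-- A full transformation α : X_n → X_n is modelled by its image vector
-- (Vec (Fin n) n), with x α = lookup α x.  (Vectors have decidable
-- equality, so sets of transformations can be counted by duplicate-free lists.)
Transformation : ℕ → Set
Transformation n = Vec (Fin n) n

_·_ : ∀ {n} → Fin n → Transformation n → Fin n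
x · α = lookup α x

OrderPreserving : ∀ {n} → Transformation n → Set
OrderPreserving {n} α = (x y : Fin n) → toℕ x ≤ toℕ y → toℕ (x · α) ≤ toℕ (y · α)

Contraction : ∀ {n} → Transformation n → Set
Contraction {n} α = (x y : Fin n) → ∣ toℕ (x · α) - toℕ (y · α) ∣ ≤ ∣ toℕ x - toℕ y ∣

IsOCT : ∀ {n} → Transformation n → Set
IsOCT α = OrderPreserving α × Contraction α

fix : ∀ {n} → Transformation n → ℕ
fix {n} α = length (filter (λ x → (x · α) ≟ x) (allFin n))

-- w⁺(α) = max (Im α), as an element of {1,…,n} (so toℕ + 1); 0 only if n = 0
w⁺ : ∀ {n} → Transformation n → ℕ
w⁺ α = foldr′ (λ y acc → suc (toℕ y) ⊔ acc) 0 α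

-- Binomial coefficient with integer arguments, a ≥ -1:
-- binom(a,b) = 0 if b < 0 or b > a, except binom(-1,-1) = 1.
binom : ℤ → ℤ → ℕ
binom -[1+ zero ] -[1+ zero ] = 1
binom -[1+ _ ] _ = 0
binom (+ a) (+ b) = a C b
binom (+ a) -[1+ _ ] = 0

Σ[_≤p≤_] : ℕ → ℕ → (ℕ → ℕ) → ℕ
Σ[ m ≤p≤ k ] g = sum (applyUpTo (λ i → g (m + i)) (suc k ∸ m))

module Submission where

-- Counting order-preserving contractions of X_n = {0,…,N} (n = N + 1) by fixed points and
-- by the largest value w⁺ = K + 1.
--
-- For such a map consecutive values differ by 0 or 1, so it is determined by its largest
-- value K (taken at the top position N) together with the bit string t of length N that
-- records, reading downwards from the top, where the values drop.  Conversely any t with at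
-- most K true bits decodes to such a map (decode, StepString).  Under this bijection the
-- number of fixed points becomes a simple recursion on t (fixesFrom), and splitting on the top
-- bit shows that the number of strings with m ≥ 1 fixed points satisfies Pascal's recurrence,
-- giving the partial row sum C(N-m,0) + … + C(N-m,K+1-m) (count-fixesFrom).  Finally the sum
-- Σ_{p=m}^{K+1} binom(n-m-1, n-p-1) of the theorem is that same row sum (binomial-sum).

open import Defs
open import Data.Bool using (Bool; true; false; not; T)
open import Data.Empty using (⊥; ⊥-elim)
open import Data.Fin using (Fin; toℕ; fromℕ) renaming (zero to fzero; suc to fsuc; _≟_ to _≟ᶠ_)
open import Data.Fin.Properties using (toℕ-injective; toℕ-fromℕ; toℕ<n)
open import Data.Integer using (+_; -[1+_]; _-_)
open import Data.Integer.Properties using (m-n≡m⊖n; ⊖-≥)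
open import Data.List using (List; []; _∷_; _++_; map; filter; length; tabulate; applyUpTo)
open import Data.List.Properties using (length-++; filter-++; length-map; filter-≐; filter-all; filter-none)
open import Data.List.Membership.Propositional using (_∈_)
open import Data.List.Membership.Propositional.Properties
  using (∈-map⁻; ∈-map⁺; ∈-filter⁻; ∈-filter⁺; ∈-++⁺ˡ; ∈-++⁺ʳ)
import Data.List.Relation.Unary.All as All
import Data.List.Relation.Unary.All.Properties as All
import Data.List.Relation.Unary.AllPairs as AllPairs
open import Data.List.Relation.Unary.Any using (here; there)
open import Data.List.Relation.Unary.Unique.Propositional using (Unique)
import Data.List.Relation.Unary.Unique.Propositional.Properties as Unique
open import Data.Nat using (ℕ; zero; suc; _+_; _∸_; _^_; _≤_; _<_; _⊔_; ∣_-_∣; _≡ᵇ_; z≤n; s≤s; s≤s⁻¹; z<s; _≟_; _≤?_)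
open import Data.Nat.Properties
open import Data.Nat.Combinatorics using (_C_; k>n⇒nCk≡0; nCk≡nC[n∸k]; nCk+nC[k+1]≡[n+1]C[k+1])
open import Data.Nat.ListAction using (sum)
open import Data.Nat.Solver using (module +-*-Solver)
open import Data.Product using (Σ; _×_; _,_; proj₁; proj₂)
open import Data.Sum using (inj₁; inj₂)
open import Data.Vec as Vec using (Vec; []; _∷_; lookup)
open import Data.Vec.Properties using (lookup∘tabulate; tabulate∘lookup; tabulate-cong)
open import Function.Bundles using (_⇔_; mk⇔)
open import Relation.Nullary using (Dec; yes; no; does)
open import Relation.Nullary.Decidable using (dec-true; dec-false)
open import Relation.Unary using (Decidable)
open import Relation.Binary.PropositionalEquality
  using (_≡_; _≢_; refl; sym; trans; cong; cong₂; subst; subst₂; module ≡-Reasoning)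

bit : Bool → ℕ
bit true  = 1
bit false = 0

bit≤1 : ∀ b → bit b ≤ 1
bit≤1 true  = s≤s z≤n
bit≤1 false = z≤n

bit-injective : ∀ {b b′} → bit b ≡ bit b′ → b ≡ b′
bit-injective {true}  {true}  _ = refl
bit-injective {false} {false} _ = refl

δ : ℕ → ℕ → ℕ
δ a b = bit (does (a ≟ b))

δ-refl : ∀ a → δ a a ≡ 1
δ-refl a = cong bit (dec-true (a ≟ a) refl)

δ-≢ : ∀ {a b} → a ≢ b → δ a b ≡ 0
δ-≢ {a} {b} a≢b = cong bit (dec-false (a ≟ b) a≢b)

bit-≟ᶠ : ∀ {n} (u v : Fin n) → bit (does (u ≟ᶠ v)) ≡ δ (toℕ u) (toℕ v)
bit-≟ᶠ u v with u ≟ᶠ v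
... | yes refl = sym (δ-refl (toℕ u))
... | no  u≢v  = sym (δ-≢ (λ e → u≢v (toℕ-injective e)))

∑< : ℕ → (ℕ → ℕ) → ℕ
∑< n g = sum (applyUpTo g n)

∑<-cong : ∀ n {g h} → (∀ i → i < n → g i ≡ h i) → ∑< n g ≡ ∑< n h
∑<-cong zero    e = refl
∑<-cong (suc n) e = cong₂ _+_ (e 0 z<s) (∑<-cong n (λ i i<n → e (suc i) (s≤s i<n)))

∑<-last : ∀ n g → ∑< (suc n) g ≡ ∑< n g + g n
∑<-last zero    g = +-comm (g 0) 0
∑<-last (suc n) g = trans (cong (λ v → g 0 + v) (∑<-last n (λ i → g (suc i)))) (sym (+-assoc (g 0) _ _))

∑<-reverse : ∀ n g → ∑< n (λ i → g (n ∸ suc i)) ≡ ∑< n g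
∑<-reverse zero    g = refl
∑<-reverse (suc n) g =
  trans (cong (λ v → g n + v) (∑<-reverse n g)) (trans (+-comm (g n) _) (sym (∑<-last n g)))

binomPrefix : ℕ → ℕ → ℕ
binomPrefix a zero    = 0
binomPrefix a (suc J) = binomPrefix a J + a C J

∑<-binomPrefix : ∀ a J {f} → (∀ i → i < J → f i ≡ a C i) → ∑< J f ≡ binomPrefix a J
∑<-binomPrefix a zero    e = refl
∑<-binomPrefix a (suc J) {f} e =
  trans (∑<-last J f) (cong₂ _+_ (∑<-binomPrefix a J (λ i i<J → e i (m≤n⇒m≤1+n i<J))) (e J (n<1+n J)))

binomPrefix-pascal : ∀ a J → binomPrefix (suc a) (suc J) ≡ binomPrefix a (suc J) + binomPrefix a J
binomPrefix-pascal a zero    = refl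
binomPrefix-pascal a (suc J) =
  trans (cong₂ _+_ (binomPrefix-pascal a J) (sym (nCk+nC[k+1]≡[n+1]C[k+1] a J)))
        (interchange (binomPrefix a (suc J)) (binomPrefix a J) (a C J) (a C suc J))
  where
  open +-*-Solver
  interchange : ∀ x y u v → (x + y) + (u + v) ≡ (x + v) + (y + u)
  interchange = solve 4 (λ x y u v → (x :+ y) :+ (u :+ v) := (x :+ v) :+ (y :+ u)) refl

binomPrefix-stable : ∀ a J → a < J → binomPrefix a (suc J) ≡ binomPrefix a J
binomPrefix-stable a J a<J = trans (cong (λ v → binomPrefix a J + v) (k>n⇒nCk≡0 a<J)) (+-identityʳ _)

binomPrefix-row : ∀ a → binomPrefix a (suc a) ≡ 2 ^ a
binomPrefix-row zero    = refl
binomPrefix-row (suc a) = begin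
  binomPrefix (suc a) (suc (suc a))              ≡⟨ binomPrefix-pascal a (suc a) ⟩
  binomPrefix a (suc (suc a)) + binomPrefix a (suc a)
    ≡⟨ cong (_+ binomPrefix a (suc a)) (binomPrefix-stable a (suc a) (n<1+n a)) ⟩
  binomPrefix a (suc a) + binomPrefix a (suc a)  ≡⟨ cong₂ _+_ (binomPrefix-row a) (binomPrefix-row a) ⟩
  2 ^ a + 2 ^ a                                  ≡⟨ cong (λ v → 2 ^ a + v) (sym (+-identityʳ (2 ^ a))) ⟩
  2 ^ suc a                                      ∎
  where open ≡-Reasoning

binomPrefix-beyond : ∀ a J → a < J → binomPrefix a J ≡ 2 ^ a
binomPrefix-beyond a (suc J) (s≤s a≤J) with m≤n⇒m<n∨m≡n a≤J
... | inj₂ refl = binomPrefix-row a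
... | inj₁ a<J  = trans (binomPrefix-stable a J a<J) (binomPrefix-beyond a J a<J)

-- The closed form of the count: with N+1 points, top value K and m ≥ 1 fixed points
-- there are binomPrefix (N - m) (K + 2 - m) transformations.
closedForm : ℕ → ℕ → ℕ → ℕ
closedForm N K m = binomPrefix (N ∸ m) (suc (suc K) ∸ m)

-- The Pascal-type recurrence satisfied by the closed form when a point is added above K.
closedForm-step : ∀ N K m → 1 ≤ m → K ≤ N →
  closedForm (suc N) K m ≡ closedForm N K m + binomPrefix (N ∸ m) (suc K ∸ m)
closedForm-step N K (suc m) _ K≤N with m ≤? K
... | no m≰K rewrite m≤n⇒m∸n≡0 (≰⇒> m≰K) | m≤n⇒m∸n≡0 (<⇒≤ (≰⇒> m≰K)) = refl
... | yes m≤K with m≤n⇒m<n∨m≡n (≤-trans m≤K K≤N)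
...   | inj₁ m<N rewrite +-∸-assoc 1 m<N | +-∸-assoc 1 m≤K = binomPrefix-pascal (N ∸ suc m) (K ∸ m)
...   | inj₂ refl with ≤-antisym m≤K K≤N
...     | refl rewrite n∸n≡0 m | m≤n⇒m∸n≡0 (n≤1+n m) = sym (+-identityʳ _)

pred-diff : ∀ a b → b < a → (+ a - + b) - + 1 ≡ + (a ∸ suc b)
pred-diff a b b<a = begin
  (+ a - + b) - + 1  ≡⟨ cong (_- + 1) (trans (m-n≡m⊖n a b) (⊖-≥ (<⇒≤ b<a))) ⟩
  + (a ∸ b) - + 1    ≡⟨ trans (m-n≡m⊖n (a ∸ b) 1) (⊖-≥ (m<n⇒0<n∸m b<a)) ⟩
  + (a ∸ b ∸ 1)      ≡⟨ cong +_ (trans (∸-+-assoc a b 1) (cong (a ∸_) (+-comm b 1))) ⟩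
  + (a ∸ suc b)      ∎
  where open ≡-Reasoning

pred-diff-self : ∀ a → (+ a - + a) - + 1 ≡ -[1+ 0 ]
pred-diff-self a = cong (_- + 1) (trans (m-n≡m⊖n a a) (trans (⊖-≥ (≤-refl {a})) (cong +_ (n∸n≡0 a))))

binom-summand : ∀ N m K i → m ≤ suc K → K ≤ N → i < suc (suc K) ∸ m →
  binom ((+ suc N - + m) - + 1) ((+ suc N - + (m + i)) - + 1) ≡ (N ∸ m) C i
binom-summand N m K i m≤1+K K≤N i<
  with m≤n⇒m<n∨m≡n (≤-trans m≤1+K (s≤s K≤N)) | m≤n⇒m<n∨m≡n (≤-trans m+i≤1+K (s≤s K≤N))
  where
  m+i≤1+K : m + i ≤ suc K
  m+i≤1+K = ≤-trans (≤-reflexive (+-comm m i)) (s≤s⁻¹ (m≤o∸n⇒m+n≤o (suc i) (m≤n⇒m≤1+n m≤1+K) i<))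
... | inj₁ (s≤s m≤N) | inj₁ (s≤s m+i≤N)
  rewrite pred-diff (suc N) m (s≤s m≤N) | pred-diff (suc N) (m + i) (s≤s m+i≤N) =
  sym (trans (nCk≡nC[n∸k] i≤N∸m) (cong ((N ∸ m) C_) (∸-+-assoc N m i)))
  where
  i≤N∸m : i ≤ N ∸ m
  i≤N∸m = m+n≤o⇒m≤o∸n i (≤-trans (≤-reflexive (+-comm i m)) m+i≤N)
... | inj₁ (s≤s m≤N) | inj₂ m+i≡1+N
  rewrite pred-diff (suc N) m (s≤s m≤N) | m+i≡1+N | pred-diff-self (suc N) = sym (k>n⇒nCk≡0 N∸m<i)
  where
  N∸m<i : N ∸ m < i
  N∸m<i = ≤-trans (≤-reflexive (sym (+-∸-assoc 1 m≤N))) (m≤n+o⇒m∸n≤o (suc N) m (≤-reflexive (sym m+i≡1+N)))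
... | inj₂ refl | _ with ≤-antisym K≤N (s≤s⁻¹ m≤1+K)
...   | refl with i | ≤-trans i< (≤-reflexive (m+n∸n≡m 1 N))
...     | zero  | _ rewrite +-identityʳ N | pred-diff-self (suc N) = refl
...     | suc _ | s≤s ()

binomial-sum : ∀ N m K → m ≤ suc K → K ≤ N →
  Σ[ m ≤p≤ suc K ] (λ p → binom ((+ suc N - + m) - + 1) ((+ suc N - + p) - + 1)) ≡ closedForm N K m
binomial-sum N m K m≤1+K K≤N =
  ∑<-binomPrefix (N ∸ m) (suc (suc K) ∸ m) (λ i i< → binom-summand N m K i m≤1+K K≤N i<)

length-filter-∷ : ∀ {A : Set} {P : A → Set} (P? : Decidable P) x xs →
  length (filter P? (x ∷ xs)) ≡ bit (does (P? x)) + length (filter P? xs)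
length-filter-∷ P? x xs with does (P? x)
... | true  = refl
... | false = refl

length-filter-map : ∀ {A B : Set} {P : B → Set} (P? : Decidable P) (f : A → B) xs →
  length (filter P? (map f xs)) ≡ length (filter (λ x → P? (f x)) xs)
length-filter-map P? f []       = refl
length-filter-map P? f (x ∷ xs) =
  trans (length-filter-∷ P? (f x) (map f xs))
        (trans (cong (λ v → bit (does (P? (f x))) + v) (length-filter-map P? f xs))
               (sym (length-filter-∷ (λ y → P? (f y)) x xs)))

length-filter-tabulate : ∀ {A : Set} {P : A → Set} (P? : Decidable P) n (f : Fin n → A) (g : ℕ → ℕ) →
  (∀ x → bit (does (P? (f x))) ≡ g (toℕ x)) → length (filter P? (tabulate f)) ≡ ∑< n g
length-filter-tabulate P? zero    f g e = refl
length-filter-tabulate P? (suc n) f g e =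
  trans (length-filter-∷ P? (f fzero) (tabulate (λ x → f (fsuc x))))
        (cong₂ _+_ (e fzero) (length-filter-tabulate P? n (λ x → f (fsuc x)) (λ i → g (suc i)) (λ x → e (fsuc x))))

strings : (N : ℕ) → List (Vec Bool N)
strings zero    = [] ∷ []
strings (suc N) = map (false ∷_) (strings N) ++ map (true ∷_) (strings N)

length-strings : ∀ N → length (strings N) ≡ 2 ^ N
length-strings zero    = refl
length-strings (suc N) = begin
  length (map (false ∷_) (strings N) ++ map (true ∷_) (strings N))
    ≡⟨ length-++ (map (false ∷_) (strings N)) ⟩
  length (map (false ∷_) (strings N)) + length (map (true ∷_) (strings N))
    ≡⟨ cong₂ _+_ (length-map (false ∷_) (strings N)) (length-map (true ∷_) (strings N)) ⟩
  length (strings N) + length (strings N)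
    ≡⟨ cong₂ _+_ (length-strings N) (trans (length-strings N) (sym (+-identityʳ (2 ^ N)))) ⟩
  2 ^ suc N ∎
  where open ≡-Reasoning

strings-complete : ∀ {N} (t : Vec Bool N) → t ∈ strings N
strings-complete []          = here refl
strings-complete (false ∷ t) = ∈-++⁺ˡ (∈-map⁺ (false ∷_) (strings-complete t))
strings-complete {suc N} (true ∷ t) = ∈-++⁺ʳ (map (false ∷_) (strings N)) (∈-map⁺ (true ∷_) (strings-complete t))

strings-unique : ∀ N → Unique (strings N)
strings-unique zero    = All.[] AllPairs.∷ AllPairs.[]
strings-unique (suc N) =
  Unique.++⁺ (Unique.map⁺ ∷-injectiveʳ (strings-unique N)) (Unique.map⁺ ∷-injectiveʳ (strings-unique N)) disjoint
  where
  ∷-injectiveʳ : ∀ {b} {t u : Vec Bool N} → b ∷ t ≡ b ∷ u → t ≡ u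
  ∷-injectiveʳ refl = refl
  disjoint : ∀ {v} → v ∈ map (false ∷_) (strings N) × v ∈ map (true ∷_) (strings N) → ⊥
  disjoint (p , q) with ∈-map⁻ (false ∷_) p | ∈-map⁻ (true ∷_) q
  ... | _ , _ , refl | _ , _ , ()

count : (N : ℕ) → (Vec Bool N → ℕ) → ℕ → ℕ
count N g m = length (filter (λ t → g t ≟ m) (strings N))

count-split : ∀ N g m → count (suc N) g m ≡ count N (λ t → g (false ∷ t)) m + count N (λ t → g (true ∷ t)) m
count-split N g m =
  trans (cong length (filter-++ P? (map (false ∷_) (strings N)) (map (true ∷_) (strings N))))
        (trans (length-++ (filter P? (map (false ∷_) (strings N))))
               (cong₂ _+_ (length-filter-map P? (false ∷_) (strings N)) (length-filter-map P? (true ∷_) (strings N))))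
  where P? = λ t → g t ≟ m

count-cong : ∀ N {g h} m → (∀ t → g t ≡ h t) → count N g m ≡ count N h m
count-cong N m g≗h =
  cong length (filter-≐ _ _ ((λ {t} e → trans (sym (g≗h t)) e) , (λ {t} e → trans (g≗h t) e)) (strings N))

count-suc : ∀ N g m → count N (λ t → suc (g t)) (suc m) ≡ count N g m
count-suc N g m = cong length (filter-≐ _ _ (suc-injective , cong suc) (strings N))

count-none : ∀ N g m → (∀ t → g t ≢ m) → count N g m ≡ 0
count-none N g m g≢m = cong length (filter-none (λ t → g t ≟ m) {xs = strings N} (All.tabulate (λ {t} _ → g≢m t)))

count-const : ∀ N m → count N (λ _ → m) m ≡ 2 ^ N
count-const N m = trans (cong length (filter-all (λ _ → m ≟ m) {xs = strings N} (All.tabulate (λ _ → refl)))) (length-strings N)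

onesUpTo : ∀ {N} → Vec Bool N → ℕ → ℕ
onesUpTo t       zero    = 0
onesUpTo []      (suc y) = 0
onesUpTo (b ∷ t) (suc y) = bit b + onesUpTo t y

ones : ∀ {N} → Vec Bool N → ℕ
ones {N} t = onesUpTo t N

onesUpTo≤ : ∀ {N} (t : Vec Bool N) y → onesUpTo t y ≤ y
onesUpTo≤ t       zero    = z≤n
onesUpTo≤ []      (suc y) = z≤n
onesUpTo≤ (b ∷ t) (suc y) = +-mono-≤ (bit≤1 b) (onesUpTo≤ t y)

onesUpTo-mono : ∀ {N} (t : Vec Bool N) {y y′} → y ≤ y′ → onesUpTo t y ≤ onesUpTo t y′
onesUpTo-mono t       {zero}           _         = z≤n
onesUpTo-mono []      {suc y} {suc y′} _         = z≤n
onesUpTo-mono (b ∷ t) {suc y} {suc y′} (s≤s y≤y′) = +-monoʳ-≤ (bit b) (onesUpTo-mono t y≤y′)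

onesUpTo-lipschitz : ∀ {N} (t : Vec Bool N) {y y′} → y ≤ y′ → onesUpTo t y′ ≤ onesUpTo t y + (y′ ∸ y)
onesUpTo-lipschitz t       {zero}  {y′}     _          = onesUpTo≤ t y′
onesUpTo-lipschitz []      {suc y} {suc y′} _          = z≤n
onesUpTo-lipschitz (b ∷ t) {suc y} {suc y′} (s≤s y≤y′) =
  ≤-trans (+-monoʳ-≤ (bit b) (onesUpTo-lipschitz t y≤y′)) (≤-reflexive (sym (+-assoc (bit b) _ _)))

-- fixesFrom K t: the number of fixed points of the sequence which takes the value K at the
-- top position N and steps down by one across each true bit of t (read from the top), or 0
-- if the sequence would drop below 0.  It is the fixed-point count of a decoded transformation.
fixesFrom : ∀ {N} → ℕ → Vec Bool N → ℕ
fixesFrom {zero}  K       []          = δ K 0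
fixesFrom {suc N} K       (false ∷ t) = δ K (suc N) + fixesFrom K t
fixesFrom {suc N} zero    (true ∷ t)  = 0
fixesFrom {suc N} (suc K) (true ∷ t)  = δ (suc K) (suc N) + fixesFrom K t

-- A sequence starting strictly above the diagonal stays above it.
fixesFrom-above : ∀ {N} K (t : Vec Bool N) → N < K → fixesFrom K t ≡ 0
fixesFrom-above {zero}  (suc K) []          _   = refl
fixesFrom-above {suc N} K       (false ∷ t) N<K =
  cong₂ _+_ (δ-≢ (>⇒≢ N<K)) (fixesFrom-above K t (<-trans (n<1+n N) N<K))
fixesFrom-above {suc N} (suc K) (true ∷ t)  N<K =
  cong₂ _+_ (δ-≢ (>⇒≢ N<K)) (fixesFrom-above K t (s≤s⁻¹ N<K))

fixesFrom-diagonal : ∀ {N} (t : Vec Bool N) → 1 ≤ fixesFrom N t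
fixesFrom-diagonal {zero}  []          = s≤s z≤n
fixesFrom-diagonal {suc N} (false ∷ t) = subst (λ v → 1 ≤ v + fixesFrom (suc N) t) (sym (δ-refl (suc N))) (s≤s z≤n)
fixesFrom-diagonal {suc N} (true ∷ t)  = subst (λ v → 1 ≤ v + fixesFrom N t) (sym (δ-refl (suc N))) (s≤s z≤n)

fixesFrom-underflow : ∀ {N} K (t : Vec Bool N) → K < ones t → fixesFrom K t ≡ 0
fixesFrom-underflow {suc N} K       (false ∷ t) K<ones =
  cong₂ _+_ (δ-≢ (<⇒≢ (≤-trans K<ones (m≤n⇒m≤1+n (onesUpTo≤ t N))))) (fixesFrom-underflow K t K<ones)
fixesFrom-underflow {suc N} zero    (true ∷ t)  _      = refl
fixesFrom-underflow {suc N} (suc K) (true ∷ t)  (s≤s K<ones) =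
  cong₂ _+_ (δ-≢ (<⇒≢ (s≤s (≤-trans K<ones (onesUpTo≤ t N))))) (fixesFrom-underflow K t K<ones)

count-fixesFrom : ∀ N K m → 1 ≤ m → K ≤ N → count N (fixesFrom K) m ≡ closedForm N K m
count-fixesFrom zero    zero (suc zero)    _   z≤n = refl
count-fixesFrom zero    zero (suc (suc m)) _   z≤n rewrite 0∸n≡0 m = refl
count-fixesFrom (suc N) K    m             1≤m K≤1+N with m≤n⇒m<n∨m≡n K≤1+N
... | inj₂ refl = trans (count-split N (fixesFrom (suc N)) m)
                        (trans (cong₂ _+_ (count-cong N m stays-above) (count-cong N m follows-diagonal))
                               (diagonal m 1≤m))
  where
  -- with the top point fixed, a false bit puts the rest above the diagonal, a true bit keeps it on it
  stays-above : ∀ t → fixesFrom (suc N) (false ∷ t) ≡ 1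
  stays-above t = cong₂ _+_ (δ-refl (suc N)) (fixesFrom-above (suc N) t (n<1+n N))
  follows-diagonal : ∀ t → fixesFrom (suc N) (true ∷ t) ≡ suc (fixesFrom N t)
  follows-diagonal t = cong (_+ fixesFrom N t) (δ-refl (suc N))
  diagonal : ∀ m → 1 ≤ m →
    count N (λ _ → 1) m + count N (λ t → suc (fixesFrom N t)) m ≡ closedForm (suc N) (suc N) m
  diagonal (suc zero) _ =
    trans (cong₂ _+_ (trans (count-suc N (λ _ → 0) 0) (count-const N 0))
                     (trans (count-suc N (fixesFrom N) 0)
                            (count-none N (fixesFrom N) 0 (λ t e → <⇒≢ (fixesFrom-diagonal t) (sym e)))))
          (trans (+-identityʳ _) (sym (binomPrefix-beyond N (suc (suc N)) (m≤n⇒m≤1+n (n<1+n N)))))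
  diagonal (suc (suc m)) _ =
    cong₂ _+_ (trans (count-suc N (λ _ → 0) (suc m)) (count-none N (λ _ → 0) (suc m) (λ _ ())))
              (trans (count-suc N (fixesFrom N) (suc m)) (count-fixesFrom N N (suc m) (s≤s z≤n) ≤-refl))
... | inj₁ (s≤s K≤N) = begin
  count (suc N) (fixesFrom K) m
    ≡⟨ count-split N (fixesFrom K) m ⟩
  count N (λ t → fixesFrom K (false ∷ t)) m + count N (λ t → fixesFrom K (true ∷ t)) m
    ≡⟨ cong₂ _+_ (trans (count-cong N m top-not-fixed) (count-fixesFrom N K m 1≤m K≤N)) (step-down K K≤N) ⟩
  closedForm N K m + binomPrefix (N ∸ m) (suc K ∸ m)
    ≡⟨ closedForm-step N K m 1≤m K≤N ⟨
  closedForm (suc N) K m ∎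
  where
  open ≡-Reasoning
  top-not-fixed : ∀ t → fixesFrom K (false ∷ t) ≡ fixesFrom K t
  top-not-fixed t = cong (_+ fixesFrom K t) (δ-≢ (<⇒≢ (s≤s K≤N)))
  -- a true top bit lowers the value to K - 1, or underflows when K = 0
  step-down : ∀ K → K ≤ N → count N (λ t → fixesFrom K (true ∷ t)) m ≡ binomPrefix (N ∸ m) (suc K ∸ m)
  step-down zero     _     =
    trans (count-none N (λ _ → 0) m (λ _ → <⇒≢ 1≤m)) (cong (binomPrefix (N ∸ m)) (sym (m≤n⇒m∸n≡0 1≤m)))
  step-down (suc K′) 1+K′≤N =
    trans (count-cong N m (λ t → cong (_+ fixesFrom K′ t) (δ-≢ (<⇒≢ (s≤s 1+K′≤N)))))
          (count-fixesFrom N K′ m 1≤m (≤-trans (n≤1+n K′) 1+K′≤N))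

clamp : (N x : ℕ) → Fin (suc N)
clamp zero    _       = fzero
clamp (suc N) zero    = fzero
clamp (suc N) (suc x) = fsuc (clamp N x)

toℕ-clamp : ∀ N {x} → x ≤ N → toℕ (clamp N x) ≡ x
toℕ-clamp zero    z≤n     = refl
toℕ-clamp (suc N) z≤n     = refl
toℕ-clamp (suc N) (s≤s p) = cong suc (toℕ-clamp N p)

clamp-toℕ : ∀ N (x : Fin (suc N)) → clamp N (toℕ x) ≡ x
clamp-toℕ zero    fzero    = refl
clamp-toℕ (suc N) fzero    = refl
clamp-toℕ (suc N) (fsuc x) = cong fsuc (clamp-toℕ N x)

-- decode N K t: the transformation of X_{N+1} with value K at the top position N whose
-- values step down by one across each true bit of t, read from the top.
decode : (N K : ℕ) → Vec Bool N → Transformation (suc N)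
decode N K t = Vec.tabulate (λ x → clamp N (K ∸ onesUpTo t (N ∸ toℕ x)))

lookup-decode : ∀ N K t x → K ≤ N → toℕ (x · decode N K t) ≡ K ∸ onesUpTo t (N ∸ toℕ x)
lookup-decode N K t x K≤N =
  trans (cong toℕ (lookup∘tabulate (λ z → clamp N (K ∸ onesUpTo t (N ∸ toℕ z))) x))
        (toℕ-clamp N (≤-trans (m∸n≤m K (onesUpTo t (N ∸ toℕ x))) K≤N))

oct-criterion : ∀ {n} (α : Transformation n) → OrderPreserving α →
  (∀ x y → toℕ x ≤ toℕ y → toℕ (y · α) ≤ toℕ (x · α) + (toℕ y ∸ toℕ x)) → IsOCT α
oct-criterion α mono lip = mono , contraction
  where
  bounded-gap : ∀ {a b d} → a ≤ b → b ≤ a + d → ∣ a - b ∣ ≤ d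
  bounded-gap {a} {b} {d} a≤b b≤a+d = subst (_≤ d) (sym (m≤n⇒∣m-n∣≡n∸m a≤b)) (m≤n+o⇒m∸n≤o b a b≤a+d)
  contraction : Contraction α
  contraction x y with ≤-total (toℕ x) (toℕ y)
  ... | inj₁ x≤y = subst (∣ toℕ (x · α) - toℕ (y · α) ∣ ≤_) (sym (m≤n⇒∣m-n∣≡n∸m x≤y))
                         (bounded-gap (mono x y x≤y) (lip x y x≤y))
  ... | inj₂ y≤x = subst₂ _≤_ (∣-∣-comm (toℕ (y · α)) (toℕ (x · α)))
                              (trans (sym (m≤n⇒∣m-n∣≡n∸m y≤x)) (∣-∣-comm (toℕ y) (toℕ x)))
                              (bounded-gap (mono y x y≤x) (lip y x y≤x))

∸-triangle : ∀ K a b → K ∸ a ≤ (K ∸ b) + (b ∸ a)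
∸-triangle K       zero    b       = subst (K ≤_) (+-comm b (K ∸ b)) (m≤n+m∸n K b)
∸-triangle zero    (suc a) b       = z≤n
∸-triangle (suc K) (suc a) zero    = ≤-trans (m∸n≤m K a) (≤-trans (n≤1+n K) (m≤m+n (suc K) 0))
∸-triangle (suc K) (suc a) (suc b) = ∸-triangle K a b

∸-reflect : ∀ N x y → (N ∸ x) ∸ (N ∸ y) ≤ y ∸ x
∸-reflect N       zero    y       = m≤n+o⇒m∸n≤o N (N ∸ y) (subst (N ≤_) (+-comm y (N ∸ y)) (m≤n+m∸n N y))
∸-reflect N       (suc x) zero    = ≤-reflexive (m≤n⇒m∸n≡0 (m∸n≤m N (suc x)))
∸-reflect zero    (suc x) (suc y) = z≤n
∸-reflect (suc N) (suc x) (suc y) = ∸-reflect N x y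

decode-OCT : ∀ N K t → K ≤ N → IsOCT (decode N K t)
decode-OCT N K t K≤N = oct-criterion (decode N K t) mono lip
  where
  mono : OrderPreserving (decode N K t)
  mono x y x≤y rewrite lookup-decode N K t x K≤N | lookup-decode N K t y K≤N =
    ∸-monoʳ-≤ K (onesUpTo-mono t (∸-monoʳ-≤ N x≤y))
  lip : ∀ x y → toℕ x ≤ toℕ y → toℕ (y · decode N K t) ≤ toℕ (x · decode N K t) + (toℕ y ∸ toℕ x)
  lip x y x≤y rewrite lookup-decode N K t x K≤N | lookup-decode N K t y K≤N =
    ≤-trans (∸-triangle K (onesUpTo t (N ∸ toℕ y)) (onesUpTo t (N ∸ toℕ x)))
      (+-monoʳ-≤ (K ∸ onesUpTo t (N ∸ toℕ x))
        (≤-trans (m≤n+o⇒m∸n≤o _ _ (onesUpTo-lipschitz t (∸-monoʳ-≤ N x≤y))) (∸-reflect N (toℕ x) (toℕ y))))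

-- w⁺ for vectors of any length: one more than the largest entry.
top : ∀ {n L} → Vec (Fin n) L → ℕ
top α = Vec.foldr′ (λ y acc → suc (toℕ y) ⊔ acc) 0 α

top-≤ : ∀ {n L} (α : Vec (Fin n) L) B → (∀ x → toℕ (lookup α x) ≤ B) → top α ≤ suc B
top-≤ []      B h = z≤n
top-≤ (a ∷ α) B h = ⊔-lub (s≤s (h fzero)) (top-≤ α B (λ x → h (fsuc x)))

top-≥ : ∀ {n L} (α : Vec (Fin n) L) x → suc (toℕ (lookup α x)) ≤ top α
top-≥ (a ∷ α) fzero    = m≤m⊔n (suc (toℕ a)) (top α)
top-≥ (a ∷ α) (fsuc x) = ≤-trans (top-≥ α x) (m≤n⊔m (suc (toℕ a)) (top α))

decode-w⁺ : ∀ N K t → K ≤ N → w⁺ (decode N K t) ≡ suc K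
decode-w⁺ N K t K≤N = ≤-antisym
  (top-≤ (decode N K t) K (λ x → subst (_≤ K) (sym (lookup-decode N K t x K≤N)) (m∸n≤m K (onesUpTo t (N ∸ toℕ x)))))
  (subst (λ v → suc v ≤ top (decode N K t)) value-at-top (top-≥ (decode N K t) (fromℕ N)))
  where
  value-at-top : toℕ (fromℕ N · decode N K t) ≡ K
  value-at-top rewrite lookup-decode N K t (fromℕ N) K≤N | toℕ-fromℕ N | n∸n≡0 N = refl

fixSum : ∀ {N} → ℕ → Vec Bool N → ℕ
fixSum {N} K t = ∑< (suc N) (λ y → δ (K ∸ onesUpTo t y) (N ∸ y))

fix-decode : ∀ N K t → K ≤ N → fix (decode N K t) ≡ fixSum K t
fix-decode N K t K≤N = begin
  fix (decode N K t)
    ≡⟨ length-filter-tabulate (λ x → (x · decode N K t) ≟ᶠ x) (suc N) (λ x → x) (λ i → g (N ∸ i)) at ⟩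
  ∑< (suc N) (λ i → g (suc N ∸ suc i))
    ≡⟨ ∑<-reverse (suc N) g ⟩
  fixSum K t ∎
  where
  open ≡-Reasoning
  g : ℕ → ℕ
  g y = δ (K ∸ onesUpTo t y) (N ∸ y)
  at : ∀ x → bit (does ((x · decode N K t) ≟ᶠ x)) ≡ g (N ∸ toℕ x)
  at x = trans (bit-≟ᶠ (x · decode N K t) x)
               (cong₂ δ (lookup-decode N K t x K≤N) (sym (m∸[m∸n]≡n (s≤s⁻¹ (toℕ<n x)))))

fixSum-∷ : ∀ {N} K b (t : Vec Bool N) → fixSum K (b ∷ t) ≡ δ K (suc N) + fixSum (K ∸ bit b) t
fixSum-∷ {N} K b t = cong (λ v → δ K (suc N) + v)
  (∑<-cong (suc N) (λ i _ → cong (λ v → δ v (N ∸ i)) (sym (∸-+-assoc K (bit b) (onesUpTo t i)))))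

fixesFrom-fixSum : ∀ {N} K (t : Vec Bool N) → ones t ≤ K → fixesFrom K t ≡ fixSum K t
fixesFrom-fixSum K [] _ = sym (+-identityʳ _)
fixesFrom-fixSum {suc N} K (false ∷ t) ones≤K =
  trans (cong (λ v → δ K (suc N) + v) (fixesFrom-fixSum K t ones≤K)) (sym (fixSum-∷ K false t))
fixesFrom-fixSum {suc N} (suc K) (true ∷ t) (s≤s ones≤K) =
  trans (cong (λ v → δ (suc K) (suc N) + v) (fixesFrom-fixSum K t ones≤K)) (sym (fixSum-∷ (suc K) true t))

decode-fix : ∀ N K t → K ≤ N → ones t ≤ K → fix (decode N K t) ≡ fixesFrom K t
decode-fix N K t K≤N ones≤K = trans (fix-decode N K t K≤N) (sym (fixesFrom-fixSum K t ones≤K))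

prefix-counts-injective : ∀ {N} (t u : Vec Bool N) → (∀ y → y ≤ N → onesUpTo t y ≡ onesUpTo u y) → t ≡ u
prefix-counts-injective []      []      _ = refl
prefix-counts-injective (b ∷ t) (c ∷ u) h with bit-injective (trans (sym (+-identityʳ (bit b)))
                                                   (trans (h 1 (s≤s z≤n)) (+-identityʳ (bit c))))
... | refl = cong (b ∷_) (prefix-counts-injective t u (λ y y≤N → +-cancelˡ-≡ (bit b) _ _ (h (suc y) (s≤s y≤N))))

decode-injective : ∀ N K t u → K ≤ N → ones t ≤ K → ones u ≤ K → decode N K t ≡ decode N K u → t ≡ u
decode-injective N K t u K≤N t-valid u-valid t≡u = prefix-counts-injective t u same-counts
  where
  same-counts : ∀ y → y ≤ N → onesUpTo t y ≡ onesUpTo u y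
  same-counts y y≤N = ∸-cancelˡ-≡ (≤-trans (onesUpTo-mono t y≤N) t-valid) (≤-trans (onesUpTo-mono u y≤N) u-valid)
    (subst (λ z → K ∸ onesUpTo t z ≡ K ∸ onesUpTo u z) position-of-y
      (trans (sym (lookup-decode N K t x K≤N)) (trans (cong (λ α → toℕ (x · α)) t≡u) (lookup-decode N K u x K≤N))))
    where
    x = clamp N (N ∸ y)
    position-of-y : N ∸ toℕ x ≡ y
    position-of-y = trans (cong (N ∸_) (toℕ-clamp N (m∸n≤m N y))) (m∸[m∸n]≡n y≤N)

onesUpTo-tabulate : ∀ N (g : ℕ → Bool) {y} → y ≤ N →
  onesUpTo (Vec.tabulate {n = N} (λ j → g (toℕ j))) y ≡ ∑< y (λ j → bit (g j))
onesUpTo-tabulate N       g {zero}  _         = refl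
onesUpTo-tabulate (suc N) g {suc y} (s≤s y≤N) = cong (λ v → bit (g 0) + v) (onesUpTo-tabulate N (λ j → g (suc j)) y≤N)

-- Every order-preserving contraction α of X_{N+1} with w⁺ α = K + 1 is decoded from its
-- string of steps: consecutive values differ by 0 or 1, so α is determined by its top value
-- K and by where it rises; the string has at most K rises since values stay ≥ 0.
module StepString (N K : ℕ) (α : Transformation (suc N)) (oct : IsOCT α) (w⁺≡ : w⁺ α ≡ suc K) where

  value : ℕ → ℕ
  value i = toℕ (clamp N i · α)

  value-mono : ∀ {i j} → i ≤ j → j ≤ N → value i ≤ value j
  value-mono {i} {j} i≤j j≤N = proj₁ oct (clamp N i) (clamp N j)
    (subst₂ _≤_ (sym (toℕ-clamp N (≤-trans i≤j j≤N))) (sym (toℕ-clamp N j≤N)) i≤j)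

  value-at : ∀ x → value (toℕ x) ≡ toℕ (x · α)
  value-at x = cong (λ z → toℕ (z · α)) (clamp-toℕ N x)

  value-top : value N ≡ K
  value-top = ≤-antisym
    (s≤s⁻¹ (subst (suc (value N) ≤_) w⁺≡ (top-≥ α (clamp N N))))
    (s≤s⁻¹ (subst (_≤ suc (value N)) w⁺≡
      (top-≤ α (value N) (λ x → subst (_≤ value N) (value-at x) (value-mono (s≤s⁻¹ (toℕ<n x)) ≤-refl)))))

  K≤N : K ≤ N
  K≤N = s≤s⁻¹ (subst (_≤ suc N) w⁺≡ (top-≤ α N (λ x → s≤s⁻¹ (toℕ<n (x · α)))))

  rises : ℕ → Bool
  rises i = not (value (suc i) ≡ᵇ value i)

  -- The contraction property: the value rises by exactly one or not at all.
  value-step : ∀ i → i < N → value (suc i) ≡ bit (rises i) + value i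
  value-step i i<N with value (suc i) ≡ᵇ value i in eq
  ... | true  = ≡ᵇ⇒≡ (value (suc i)) (value i) (subst T (sym eq) _)
  ... | false = ≤-antisym at-most-one at-least-one
    where
    no-fall : value i ≤ value (suc i)
    no-fall = value-mono (n≤1+n i) i<N
    gap-one : ∣ toℕ (clamp N i) - toℕ (clamp N (suc i)) ∣ ≡ 1
    gap-one rewrite toℕ-clamp N (<⇒≤ i<N) | toℕ-clamp N i<N = trans (m≤n⇒∣m-n∣≡n∸m (n≤1+n i)) (m+n∸n≡m 1 i)
    rise≤1 : value (suc i) ∸ value i ≤ 1
    rise≤1 = subst₂ _≤_ (m≤n⇒∣m-n∣≡n∸m no-fall) gap-one (proj₂ oct (clamp N i) (clamp N (suc i)))
    at-most-one : value (suc i) ≤ 1 + value i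
    at-most-one = subst (value (suc i) ≤_) (+-comm (value i) 1)
      (subst (_≤ value i + 1) (m+[n∸m]≡n no-fall) (+-monoʳ-≤ (value i) rise≤1))
    at-least-one : 1 + value i ≤ value (suc i)
    at-least-one = ≤∧≢⇒< no-fall (λ e → subst T eq (≡⇒≡ᵇ (value (suc i)) (value i) (sym e)))

  -- bit j of the string is the step between positions N - j - 1 and N - j
  steps : Vec Bool N
  steps = Vec.tabulate (λ j → rises (N ∸ suc (toℕ j)))

  telescope : ∀ y → y ≤ N → onesUpTo steps y + value (N ∸ y) ≡ value N
  telescope zero    _     = refl
  telescope (suc y) y<N = begin
    onesUpTo steps (suc y) + value i
      ≡⟨ cong (_+ value i) (trans (onesUpTo-tabulate N step-down y<N) (∑<-last y (λ j → bit (step-down j)))) ⟩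
    (∑< y (λ j → bit (step-down j)) + bit (rises i)) + value i
      ≡⟨ +-assoc (∑< y (λ j → bit (step-down j))) (bit (rises i)) (value i) ⟩
    ∑< y (λ j → bit (step-down j)) + (bit (rises i) + value i)
      ≡⟨ cong (λ v → ∑< y (λ j → bit (step-down j)) + v) (sym (value-step i (∸-monoʳ-< z<s y<N))) ⟩
    ∑< y (λ j → bit (step-down j)) + value (suc i)
      ≡⟨ cong (λ v → ∑< y (λ j → bit (step-down j)) + value v) (sym (+-∸-assoc 1 y<N)) ⟩
    ∑< y (λ j → bit (step-down j)) + value (N ∸ y)
      ≡⟨ cong (_+ value (N ∸ y)) (sym (onesUpTo-tabulate N step-down (<⇒≤ y<N))) ⟩
    onesUpTo steps y + value (N ∸ y)
      ≡⟨ telescope y (<⇒≤ y<N) ⟩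
    value N ∎
    where
    open ≡-Reasoning
    i = N ∸ suc y
    step-down : ℕ → Bool
    step-down j = rises (N ∸ suc j)

  steps-valid : ones steps ≤ K
  steps-valid = subst (ones steps ≤_) (trans (telescope N ≤-refl) value-top) (m≤m+n (ones steps) (value (N ∸ N)))

  decode-steps : decode N K steps ≡ α
  decode-steps = trans (tabulate-cong entry) (tabulate∘lookup α)
    where
    entry : ∀ x → clamp N (K ∸ onesUpTo steps (N ∸ toℕ x)) ≡ lookup α x
    entry x = toℕ-injective (trans (toℕ-clamp N (≤-trans (m∸n≤m K o) K≤N)) (trans K∸o≡value (value-at x)))
      where
      o = onesUpTo steps (N ∸ toℕ x)
      o+value≡K : o + value (toℕ x) ≡ K
      o+value≡K = trans (cong (λ z → o + value z) (sym (m∸[m∸n]≡n (s≤s⁻¹ (toℕ<n x)))))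
                        (trans (telescope (N ∸ toℕ x) (m∸n≤m N (toℕ x))) value-top)
      K∸o≡value : K ∸ o ≡ value (toℕ x)
      K∸o≡value = trans (cong (_∸ o) (sym o+value≡K)) (m+n∸m≡n o (value (toℕ x)))

map-unique : ∀ {A B : Set} (f : A → B) {xs : List A} → Unique xs →
  (∀ {x y} → x ∈ xs → y ∈ xs → f x ≡ f y → x ≡ y) → Unique (map f xs)
map-unique f AllPairs.[] inj = AllPairs.[]
map-unique f {x ∷ xs} (x∉xs AllPairs.∷ xs!) inj =
  All.map⁺ (All.tabulate (λ {y} y∈xs fx≡fy → All.lookup x∉xs y∈xs (inj (here refl) (there y∈xs) fx≡fy)))
  AllPairs.∷ map-unique f xs! (λ p q → inj (there p) (there q))

module Enumeration (N K m : ℕ) (K≤N : K ≤ N) (1≤m : 1 ≤ m) where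

  has-m? : (t : Vec Bool N) → Dec (fixesFrom K t ≡ m)
  has-m? t = fixesFrom K t ≟ m

  octs : List (Transformation (suc N))
  octs = map (decode N K) (filter has-m? (strings N))

  no-underflow : ∀ {t : Vec Bool N} → fixesFrom K t ≡ m → ones t ≤ K
  no-underflow {t} fixes≡m with ones t ≤? K
  ... | yes ones≤K = ones≤K
  ... | no  ones≰K = ⊥-elim (<⇒≢ 1≤m (trans (sym (fixesFrom-underflow K t (≰⇒> ones≰K))) fixes≡m))

  selected : ∀ {t : Vec Bool N} → t ∈ filter has-m? (strings N) → fixesFrom K t ≡ m
  selected t∈ = proj₂ (∈-filter⁻ has-m? {xs = strings N} t∈)

  octs-unique : Unique octs
  octs-unique = map-unique (decode N K) (Unique.filter⁺ has-m? (strings-unique N))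
    (λ p q → decode-injective N K _ _ K≤N (no-underflow (selected p)) (no-underflow (selected q)))

  octs-spec : ∀ α → (α ∈ octs) ⇔ (IsOCT α × fix α ≡ m × w⁺ α ≡ suc K)
  octs-spec α = mk⇔ sound complete
    where
    sound : α ∈ octs → IsOCT α × fix α ≡ m × w⁺ α ≡ suc K
    sound α∈ with ∈-map⁻ (decode N K) α∈
    ... | t , t∈ , refl = decode-OCT N K t K≤N
                        , trans (decode-fix N K t K≤N (no-underflow (selected t∈))) (selected t∈)
                        , decode-w⁺ N K t K≤N
    complete : IsOCT α × fix α ≡ m × w⁺ α ≡ suc K → α ∈ octs
    complete (oct , fix≡m , w⁺≡) =
      subst (_∈ octs) decode-steps (∈-map⁺ (decode N K) (∈-filter⁺ has-m? (strings-complete steps) steps-fixes))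
      where
      open StepString N K α oct w⁺≡ using (steps; steps-valid; decode-steps)
      steps-fixes : fixesFrom K steps ≡ m
      steps-fixes = trans (sym (decode-fix N K steps K≤N steps-valid)) (trans (cong fix decode-steps) fix≡m)

  octs-length : length octs ≡ closedForm N K m
  octs-length = trans (length-map (decode N K) (filter has-m? (strings N))) (count-fixesFrom N K m 1≤m K≤N)

corollary2p6 : (n m k : ℕ) → 1 ≤ n → 1 ≤ m → m ≤ k → k ≤ n →
    Σ (List (Transformation n)) λ xs →
      Unique xs
      × ((α : Transformation n) → (α ∈ xs) ⇔ (IsOCT α × fix α ≡ m × w⁺ α ≡ k))
      × length xs ≡ Σ[ m ≤p≤ k ] (λ p → binom ((+ n - + m) - + 1) ((+ n - + p) - + 1))
corollary2p6 (suc N) m@(suc _) (suc K) _ 1≤m m≤1+K (s≤s K≤N) =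
  octs , octs-unique , octs-spec , trans octs-length (sym (binomial-sum N m K m≤1+K K≤N))
  where open Enumeration N K m K≤N 1≤m
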